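{- Let $M$ be a loopless matroid on $E$, let $p:\mathbb{R}^{\mathcal{P}(M)}\to L_M$ be the quotient map, let $\hat0=F_0\subsetneq F_1\subsetneq\cdots\subsetneq F_\ell\subsetneq E$ be a chain of flats, and let $\mathbf{u}\in L_M$. Then there exists $\mathbf{t}\in\mathbb{R}^{\mathcal{P}(M)}$ with $p(\mathbf{t})=\mathbf{u}$ and $t_{F_j}=0$ for all $j=1,\dots,\ell$.
   Context: A matroid $M$ on a finite set $E$ is a collection $\mathcal{L}(M)$ of subsets of $E$ (flats) such that (F1) $E$ is a flat; (F2) intersections of flats are flats; (F3) for every flat $F$, the sets $F_j\setminus F$, for $F_j$ ranging over the minimal flats properly containing $F$, partition $E\setminus F$. $\hat0$ is the intersection of all flats, $\hat1=E$; $M$ is loopless if $\hat0=\emptyset$. $\mathcal{P}(M)=\mathcal{L}(M)\setminus\{\hat0,\hat1\}$. $\mathbb{R}^{\mathcal{P}(M)}$ has basis $\{\delta_F\}_{F\in\mathcal{P}(M)}$ and a vector is written $\mathbf{t}=\sum_F t_F\delta_F$. For $i\in E$, $\alpha_i=\sum_{F\in\mathcal{P}(M),\,i\in F}\delta_F$; $W_M=\operatorname{span}\{\alpha_i-\alpha_j:i,j\in E\}$ and $L_M=\mathbb{R}^{\mathcal{P}(M)}/W_M$. -}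

module Defs where

open import Level using (Level; _⊔_)
open import Data.Nat using (ℕ; zero; suc)
open import Data.Fin using (Fin; zero; suc)
open import Data.Fin.Subset using (Subset; _∈_; _∉_; _⊆_; _⊂_; _∩_; ⊤)
open import Data.Product using (Σ; _×_; ∃; ∃-syntax; Σ-syntax)
open import Relation.Nullary using (¬_)
open import Relation.Binary.PropositionalEquality using (_≡_)
open import Data.Bool.Base using (if_then_else_)
open import Data.Vec.Base using (lookup)
open import Algebra.Bundles using (CommutativeRing)

record Field (c ℓ : Level) : Set (Level.suc (c ⊔ ℓ)) where
  field
    commutativeRing : CommutativeRing c ℓ
  open CommutativeRing commutativeRing public
  field
    0≉1     : ¬ (0# ≈ 1#)
    inverse : ∀ x → ¬ (x ≈ 0#) → ∃[ y ] (x * y ≈ 1#)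

module _ {n : ℕ} (IsFlat : Subset n → Set) where

  Covers : Subset n → Subset n → Set
  Covers F G = IsFlat G × F ⊂ G ×
               (∀ H → IsFlat H → F ⊂ H → H ⊆ G → H ≡ G)

record Matroid (n : ℕ) : Set₁ where
  field
    IsFlat : Subset n → Set
    E-flat : IsFlat ⊤
    -- (F2) (binary intersections; together with F1 this gives all
    --       intersections of the finitely many flats)
    ∩-flat : ∀ F G → IsFlat F → IsFlat G → IsFlat (F ∩ G)
    -- (F3) for every flat F, the sets G \ F, G ranging over the flats
    --      covering F, partition E \ F
    partition-cover  : ∀ F → IsFlat F → ∀ e → e ∉ F →
                       ∃[ G ] (Covers IsFlat F G × e ∈ G)
    partition-unique : ∀ F → IsFlat F → ∀ e → e ∉ F → ∀ G H →
                       Covers IsFlat F G → Covers IsFlat F H →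
                       e ∈ G → e ∈ H → G ≡ H

module _ {n : ℕ} (M : Matroid n) where
  open Matroid M

  IsBottom : Subset n → Set
  IsBottom F = IsFlat F × (∀ G → IsFlat G → F ⊆ G)

  -- loopless: the intersection of all flats is empty,
  -- i.e. no element lies in every flat
  Loopless : Set
  Loopless = ∀ (e : Fin n) → ∃[ F ] (IsFlat F × e ∉ F)

  InP : Subset n → Set
  InP F = IsFlat F × ¬ IsBottom F × ¬ (F ≡ ⊤)

-- Vectors in K^{𝒫(M)}, W_M and the quotient L_M.
-- A vector t ∈ K^{𝒫(M)} is represented by a function Subset n → K,
-- only its values at F ∈ 𝒫(M) being meaningful.

module Linear {c ℓ : Level} (K : Field c ℓ) where
  open Field K using (Carrier; _≈_; _+_; _*_; _-_; 0#; 1#)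

  ∑ : (m : ℕ) → (Fin m → Carrier) → Carrier
  ∑ zero    f = 0#
  ∑ (suc m) f = f zero + ∑ m (λ i → f (suc i))

  Vect : ℕ → Set c
  Vect n = Subset n → Carrier

  α : {n : ℕ} → Fin n → Vect n
  α i F = if lookup F i then 1# else 0#

  InW : {n : ℕ} → Matroid n → Vect n → Set (c ⊔ ℓ)
  InW {n} M w = Σ[ coeff ∈ (Fin n → Fin n → Carrier) ]
    (∀ F → InP M F →
       w F ≈ ∑ n (λ i → ∑ n (λ j → coeff i j * (α i F - α j F))))

  SameClass : {n : ℕ} → Matroid n → Vect n → Vect n → Set (c ⊔ ℓ)
  SameClass M t s = InW M (λ F → t F - s F)

-- Only the strictness of the chain matters. Adding k (α_a − α_b) to a vector does not change its
-- class, and its δ_F-coordinate changes by k if a ∈ F ∌ b, by −k if b ∈ F ∌ a, and not at all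
-- otherwise. Choose a ∉ F_ℓ (possible as F_ℓ ≠ E) and b ∈ F_ℓ ∖ F_{ℓ−1}: then a and b lie in no
-- F_j with j < ℓ, so the coordinate at F_ℓ can be cleared without disturbing F_1, …, F_{ℓ−1},
-- which are handled first by induction on ℓ.
module Submission where

open import Defs
open import Data.Nat using (ℕ; suc)
open import Data.Fin using (Fin; zero; suc; inject₁; fromℕ; punchIn)
open import Data.Fin.Induction using (>-weakInduction)
open import Data.Fin.Properties using (punchInᵢ≢i)
open import Data.Fin.Subset using (Subset; _⊂_; ⊤; _⊆_; _∈_; _∉_)
open import Data.Fin.Subset.Properties using (⊂-trans)
open import Data.Product using (_×_; ∃-syntax; _,_; proj₁)
open import Data.Bool.Base using (true; false)
open import Data.Vec.Base using (lookup)
open import Data.Vec.Properties using ([]=⇒lookup; lookup⇒[]=)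
open import Data.Empty using (⊥-elim)
open import Function using (_∘_; id)
open import Relation.Binary.PropositionalEquality as ≡ using (_≡_; _≢_)
import Algebra.Properties.Ring as RingProperties
import Algebra.Properties.Semiring.Sum as SemiringSum
import Relation.Binary.Reasoning.Setoid as SetoidReasoning

data LastOrInject₁ (l : ℕ) : Fin (suc l) → Set where
  last : LastOrInject₁ l (fromℕ l)
  init : (j : Fin l) → LastOrInject₁ l (inject₁ j)

lastOrInject₁ : ∀ {l} (j : Fin (suc l)) → LastOrInject₁ l j
lastOrInject₁ {ℕ.zero} zero    = last
lastOrInject₁ {suc l}  zero    = init zero
lastOrInject₁ {suc l}  (suc j) with lastOrInject₁ j
... | last   = last
... | init k = init (suc k)

chain-⊆-last : ∀ {n l} (F : Fin (suc l) → Subset n) →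
               (∀ k → F (inject₁ k) ⊆ F (suc k)) → ∀ k → F k ⊆ F (fromℕ l)
chain-⊆-last {l = l} F chain =
  >-weakInduction (λ k → F k ⊆ F (fromℕ l)) id (λ k ⊆last → ⊆last ∘ chain k)

module _ {c ℓ} (K : Field c ℓ) where
  open Field K hiding (zero)
  open Linear K
  open RingProperties ring using (-1*x≈-x)
  open SemiringSum semiring using (sum; sum-remove; sum-cong-≋; sum-replicate-zero)
    renaming (∑-distrib-+ to sum-distrib-+)
  open SetoidReasoning setoid

  ∑≡sum : ∀ m (f : Fin m → Carrier) → ∑ m f ≡ sum f
  ∑≡sum ℕ.zero  f = ≡.refl
  ∑≡sum (suc m) f = ≡.cong (f zero +_) (∑≡sum m (f ∘ suc))

  ∑-cong : ∀ m {f g : Fin m → Carrier} → (∀ i → f i ≈ g i) → ∑ m f ≈ ∑ m g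
  ∑-cong m {f} {g} f≈g = begin
    ∑ m f  ≡⟨ ∑≡sum m f ⟩
    sum f  ≈⟨ sum-cong-≋ f≈g ⟩
    sum g  ≡⟨ ∑≡sum m g ⟨
    ∑ m g  ∎

  ∑-zero : ∀ m {f : Fin m → Carrier} → (∀ i → f i ≈ 0#) → ∑ m f ≈ 0#
  ∑-zero m f≈0 = trans (∑-cong m f≈0) (trans (reflexive (∑≡sum m _)) (sum-replicate-zero m))

  ∑-distrib-+ : ∀ m (f g : Fin m → Carrier) → ∑ m (λ i → f i + g i) ≈ ∑ m f + ∑ m g
  ∑-distrib-+ m f g = begin
    ∑ m (λ i → f i + g i)  ≡⟨ ∑≡sum m _ ⟩
    sum (λ i → f i + g i)  ≈⟨ sum-distrib-+ f g ⟩
    sum f + sum g          ≡⟨ ≡.cong₂ _+_ (∑≡sum m f) (∑≡sum m g) ⟨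
    ∑ m f + ∑ m g          ∎

  ∑-single : ∀ m (f : Fin m → Carrier) (a : Fin m) → (∀ i → i ≢ a → f i ≈ 0#) → ∑ m f ≈ f a
  ∑-single (suc m) f a f≈0 = begin
    ∑ (suc m) f                        ≡⟨ ∑≡sum (suc m) f ⟩
    sum f                              ≈⟨ sum-remove {i = a} f ⟩
    f a + sum (λ j → f (punchIn a j))  ≈⟨ +-congˡ rest≈0 ⟩
    f a + 0#                           ≈⟨ +-identityʳ (f a) ⟩
    f a                                ∎
    where
    rest≈0 : sum (λ j → f (punchIn a j)) ≈ 0#
    rest≈0 = trans (sum-cong-≋ (λ j → f≈0 _ (punchInᵢ≢i a j))) (sum-replicate-zero m)

  kronecker : ∀ {n} → Fin n → Fin n → Carrier
  kronecker zero    zero    = 1#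
  kronecker zero    (suc _) = 0#
  kronecker (suc _) zero    = 0#
  kronecker (suc i) (suc j) = kronecker i j

  kronecker-diag : ∀ {n} (a : Fin n) → kronecker a a ≈ 1#
  kronecker-diag zero    = refl
  kronecker-diag (suc a) = kronecker-diag a

  kronecker-off : ∀ {n} {i a : Fin n} → i ≢ a → kronecker i a ≈ 0#
  kronecker-off {i = zero}  {zero}  i≢a = ⊥-elim (i≢a ≡.refl)
  kronecker-off {i = zero}  {suc a} i≢a = refl
  kronecker-off {i = suc i} {zero}  i≢a = refl
  kronecker-off {i = suc i} {suc a} i≢a = kronecker-off (i≢a ∘ ≡.cong suc)

  α-∈ : ∀ {n} {a : Fin n} {H : Subset n} → a ∈ H → α a H ≈ 1#
  α-∈ a∈H rewrite []=⇒lookup a∈H = refl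

  α-∉ : ∀ {n} {a : Fin n} {H : Subset n} → a ∉ H → α a H ≈ 0#
  α-∉ {a = a} {H} a∉H with lookup H a in eq
  ... | true  = ⊥-elim (a∉H (lookup⇒[]= a H eq))
  ... | false = refl

  module _ {n} (M : Matroid n) where

    InW-cong : ∀ {w w′ : Vect n} → InW M w → (∀ F → w F ≈ w′ F) → InW M w′
    InW-cong (coeff , w≈) w≈w′ = coeff , λ F F∈𝒫 → trans (sym (w≈w′ F)) (w≈ F F∈𝒫)

    InW-zero : InW M (λ _ → 0#)
    InW-zero = (λ _ _ → 0#) , λ _ _ → sym (∑-zero n (λ _ → ∑-zero n (λ _ → zeroˡ _)))

    InW-+ : ∀ {w w′ : Vect n} → InW M w → InW M w′ → InW M (λ F → w F + w′ F)
    InW-+ (coeff , w≈) (coeff′ , w′≈) = (λ i j → coeff i j + coeff′ i j) , λ F F∈𝒫 →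
      trans (+-cong (w≈ F F∈𝒫) (w′≈ F F∈𝒫)) (sym (
        trans (∑-cong n (λ i → trans (∑-cong n (λ j → distribʳ _ _ _)) (∑-distrib-+ n _ _)))
              (∑-distrib-+ n _ _)))

    InW-*-generator : ∀ (k : Carrier) (a b : Fin n) → InW M (λ F → k * (α a F - α b F))
    InW-*-generator k a b = coeff , λ F _ → sym (begin
      ∑ n (λ i → ∑ n (λ j → coeff i j * (α i F - α j F)))
        ≈⟨ ∑-single n _ a (λ i i≢a → ∑-zero n (λ j → row-vanishes {j = j} i≢a)) ⟩
      ∑ n (λ j → coeff a j * (α a F - α j F))
        ≈⟨ ∑-single n _ b (λ j j≢b → column-vanishes j≢b) ⟩
      coeff a b * (α a F - α b F)
        ≈⟨ *-congʳ coeff-ab ⟩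
      k * (α a F - α b F) ∎)
      where
      coeff : Fin n → Fin n → Carrier
      coeff i j = kronecker i a * (kronecker j b * k)

      row-vanishes : ∀ {i j x} → i ≢ a → coeff i j * x ≈ 0#
      row-vanishes i≢a = trans (*-congʳ (trans (*-congʳ (kronecker-off i≢a)) (zeroˡ _))) (zeroˡ _)

      column-vanishes : ∀ {j x} → j ≢ b → coeff a j * x ≈ 0#
      column-vanishes j≢b = trans (*-congʳ (trans (*-congˡ (trans (*-congʳ (kronecker-off j≢b)) (zeroˡ _)))
                                                  (zeroʳ _)))
                                  (zeroˡ _)

      coeff-ab : coeff a b ≈ k
      coeff-ab = trans (*-cong (kronecker-diag a) (*-congʳ (kronecker-diag b)))
                       (trans (*-identityˡ _) (*-identityˡ k))

    SameClass-refl : ∀ (s : Vect n) → SameClass M s s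
    SameClass-refl s = InW-cong InW-zero (λ F → sym (-‿inverseʳ (s F)))

    SameClass-+ : ∀ {t s w : Vect n} → SameClass M t s → InW M w → SameClass M (λ F → t F + w F) s
    SameClass-+ {t} {s} {w} t~s w∈W = InW-cong (InW-+ t~s w∈W) λ F → begin
      (t F - s F) + w F    ≈⟨ +-assoc _ _ _ ⟩
      t F + (- s F + w F)  ≈⟨ +-congˡ (+-comm _ _) ⟩
      t F + (w F - s F)    ≈⟨ +-assoc _ _ _ ⟨
      (t F + w F) - s F    ∎

  α-difference-∉-∈ : ∀ {n} {a b : Fin n} {H : Subset n} → a ∉ H → b ∈ H → α a H - α b H ≈ - 1#
  α-difference-∉-∈ a∉H b∈H = trans (+-cong (α-∉ a∉H) (-‿cong (α-∈ b∈H))) (+-identityˡ _)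

  α-difference-∉-∉ : ∀ {n} {a b : Fin n} {H : Subset n} → a ∉ H → b ∉ H → α a H - α b H ≈ 0#
  α-difference-∉-∉ a∉H b∉H = trans (+-cong (α-∉ a∉H) (-‿cong (α-∉ b∉H))) (-‿inverseʳ 0#)

  vanishing-representative :
    ∀ {n} (M : Matroid n) (l : ℕ) (F : Fin (suc l) → Subset n) →
    (∀ k → F (inject₁ k) ⊂ F (suc k)) → F (fromℕ l) ⊂ ⊤ → (s : Vect n) →
    ∃[ t ] (SameClass M t s × (∀ j → t (F (suc j)) ≈ 0#))
  vanishing-representative M ℕ.zero F _ _ s = s , SameClass-refl M s , λ ()
  vanishing-representative M (suc l) F chain F-last⊂⊤ s
    with chain (fromℕ l) | F-last⊂⊤
  ... | (_ , b , b∈G , b∉) | (_ , a , _ , a∉G)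
    with vanishing-representative M l (F ∘ inject₁) (chain ∘ inject₁)
           (⊂-trans (chain (fromℕ l)) F-last⊂⊤) s
  ... | t , t~s , t-vanishes = t⁺ , SameClass-+ M t~s (InW-*-generator M (t G) a b) , t⁺-vanishes
    where
    G = F (fromℕ (suc l))

    t⁺ : Vect _
    t⁺ H = t H + t G * (α a H - α b H)

    t⁺-vanishes : ∀ j → t⁺ (F (suc j)) ≈ 0#
    t⁺-vanishes j with lastOrInject₁ j
    ... | last = begin
      t G + t G * (α a G - α b G)  ≈⟨ +-congˡ (*-congˡ (α-difference-∉-∈ a∉G b∈G)) ⟩
      t G + t G * (- 1#)           ≈⟨ +-congˡ (trans (*-comm _ _) (-1*x≈-x (t G))) ⟩
      t G + - t G                  ≈⟨ -‿inverseʳ (t G) ⟩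
      0#                           ∎
    ... | init i = begin
      t H + t G * (α a H - α b H)  ≈⟨ +-cong (t-vanishes i) (*-congˡ (α-difference-∉-∉ a∉H b∉H)) ⟩
      0# + t G * 0#                ≈⟨ +-identityˡ _ ⟩
      t G * 0#                     ≈⟨ zeroʳ (t G) ⟩
      0#                           ∎
      where
      H = F (suc (inject₁ i))
      a∉H : a ∉ H
      a∉H = a∉G ∘ chain-⊆-last F (proj₁ ∘ chain) (suc (inject₁ i))
      b∉H : b ∉ H
      b∉H = b∉ ∘ chain-⊆-last (F ∘ inject₁) (proj₁ ∘ chain ∘ inject₁) (suc i)

mainTheorem14 : ∀ {c ℓ} (K : Field c ℓ) {n : ℕ} (M : Matroid n) →
    Loopless M →
    (l : ℕ) (F : Fin (suc l) → Subset n) →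
    (∀ k → Matroid.IsFlat M (F k)) →
    IsBottom M (F zero) →
    (∀ (k : Fin l) → F (inject₁ k) ⊂ F (suc k)) →
    F (fromℕ l) ⊂ ⊤ →
    (s : Linear.Vect K n) →
    ∃[ t ] (Linear.SameClass K M t s ×
    (∀ (j : Fin l) → Field._≈_ K (t (F (suc j))) (Field.0# K)))
mainTheorem14 K M _ l F _ _ = vanishing-representative K M l F
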